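{- Let $A$ be a binary matrix and let $U$ be a base of $A$ (with respect to the binary rank) that is disjoint in rows. If in addition $A$ has the Unique base rows sums property, then $U$ spans every base of $A$, and thus $A$ has the Augmentation property for the binary rank.
   Context: A binary matrix has entries in $\{0,1\}$. The binary rank $R_{binary}(A)$ of an $n\times m$ binary matrix $A$ is the minimal $k$ such that $A=X\cdot Y$ with $X$ an $n\times k$ and $Y$ a $k\times m$ binary matrix (ordinary arithmetic); with $k=R_{binary}(A)$ this is an optimal binary decomposition. A set $S$ of binary vectors spans a set $T$ if every vector of $T$ is the ordinary sum of a subset of $S$. A base of $A$ is a set of vectors in $\{0,1\}^n$ spanning all columns of $A$ of minimum cardinality among such sets. A base is disjoint in rows if no two of its vectors have a $1$ in the same coordinate. $A$ has the Unique base rows sums property if for every optimal binary decomposition $A=X\cdot Y$, $Y$ does not contain two disjoint nonempty subsets of rows with equal sums. $A$ has the Augmentation property for the binary rank if for any binary column vectors $x_1,\dots,x_t$ with $R_{binary}(A|x_i)=R_{binary}(A)$ for all $i$, also $R_{binary}(A|x_1,\dots,x_t)=R_{binary}(A)$, where $(A|x_1,\dots,x_t)$ is $A$ with the columns appended. -}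

module Defs where

open import Data.Nat using (ℕ; zero; suc; _+_; _*_; _≤_)
open import Data.Bool using (Bool; true; false)
open import Data.Fin using (Fin; zero; suc; splitAt)
open import Data.Sum using (_⊎_; inj₁; inj₂; [_,_]′)
open import Data.Product using (Σ; _×_; ∃; ∃-syntax)
open import Relation.Binary.PropositionalEquality using (_≡_; _≢_)
open import Relation.Nullary using (¬_)
open import Function.Definitions using (Injective)

-- binary entries are Bool; arithmetic is done in ℕ ("ordinary arithmetic")
⟦_⟧ : Bool → ℕ
⟦ true ⟧  = 1
⟦ false ⟧ = 0

∑ : (k : ℕ) → (Fin k → ℕ) → ℕ
∑ zero    f = 0
∑ (suc k) f = f zero + ∑ k (λ l → f (suc l))

BinVec : ℕ → Set
BinVec n = Fin n → Bool

BinMat : ℕ → ℕ → Set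
BinMat n m = Fin n → Fin m → Bool

col : ∀ {n m} → BinMat n m → Fin m → BinVec n
col A j i = A i j

IsDecomp : ∀ {n m k} → BinMat n m → BinMat n k → BinMat k m → Set
IsDecomp {n} {m} {k} A X Y =
  ∀ (i : Fin n) (j : Fin m) → ⟦ A i j ⟧ ≡ ∑ k (λ l → ⟦ X i l ⟧ * ⟦ Y l j ⟧)

HasDecomp : ∀ {n m} → BinMat n m → ℕ → Set
HasDecomp {n} {m} A k = Σ (BinMat n k) λ X → Σ (BinMat k m) λ Y → IsDecomp A X Y

IsBinaryRank : ∀ {n m} → BinMat n m → ℕ → Set
IsBinaryRank A r = HasDecomp A r × (∀ k → HasDecomp A k → r ≤ k)

IsOptimalDecomp : ∀ {n m k} → BinMat n m → BinMat n k → BinMat k m → Set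
IsOptimalDecomp {k = k} A X Y = IsDecomp A X Y × IsBinaryRank A k

-- a set S = {U l | l < k} of binary vectors (injective family) spans v:
-- v is the ordinary sum of a subset of S
SpansVec : ∀ {n k} → (Fin k → BinVec n) → BinVec n → Set
SpansVec {n} {k} U v =
  Σ (Fin k → Bool) λ s → (∀ (i : Fin n) → ⟦ v i ⟧ ≡ ∑ k (λ l → ⟦ s l ⟧ * ⟦ U l i ⟧))

Spans : ∀ {n k k'} → (Fin k → BinVec n) → (Fin k' → BinVec n) → Set
Spans U V = ∀ l' → SpansVec U (V l')

SpansColumns : ∀ {n m k} → BinMat n m → (Fin k → BinVec n) → Set
SpansColumns A U = Spans U (col A)

IsBase : ∀ {n m k} → BinMat n m → (Fin k → BinVec n) → Set
IsBase {n} {m} {k} A U =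
  Injective _≡_ _≡_ U × SpansColumns A U ×
  (∀ k' (V : Fin k' → BinVec n) → Injective _≡_ _≡_ V → SpansColumns A V → k ≤ k')

DisjointInRows : ∀ {n k} → (Fin k → BinVec n) → Set
DisjointInRows {n} {k} U =
  ∀ (l l' : Fin k) (i : Fin n) → l ≢ l' → U l i ≡ true → U l' i ≡ true → Data.Empty.⊥
  where import Data.Empty

-- subsets of the rows of Y, as characteristic functions
NonEmpty : ∀ {k} → (Fin k → Bool) → Set
NonEmpty {k} s = Σ (Fin k) λ l → s l ≡ true

DisjointSubsets : ∀ {k} → (Fin k → Bool) → (Fin k → Bool) → Set
DisjointSubsets {k} s t = ∀ (l : Fin k) → s l ≡ true → t l ≡ true → Data.Empty.⊥
  where import Data.Empty

RowSum : ∀ {k m} → BinMat k m → (Fin k → Bool) → Fin m → ℕ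
RowSum {k} Y s j = ∑ k (λ l → ⟦ s l ⟧ * ⟦ Y l j ⟧)

UniqueBaseRowsSums : ∀ {n m} → BinMat n m → Set
UniqueBaseRowsSums {n} {m} A =
  ∀ k (X : BinMat n k) (Y : BinMat k m) → IsOptimalDecomp A X Y →
  ∀ (s t : Fin k → Bool) → NonEmpty s → NonEmpty t → DisjointSubsets s t →
  ¬ (∀ j → RowSum Y s j ≡ RowSum Y t j)

appendCols : ∀ {n m t} → BinMat n m → (Fin t → BinVec n) → BinMat n (m + t)
appendCols {m = m} A xs i j = [ (λ c → A i c) , (λ c → xs c i) ]′ (splitAt m j)

appendCol : ∀ {n m} → BinMat n m → BinVec n → BinMat n (m + 1)
appendCol A x = appendCols A (λ (_ : Fin 1) → x)

AugmentationProperty : ∀ {n m} → BinMat n m → Set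
AugmentationProperty {n} {m} A =
  ∀ r → IsBinaryRank A r →
  ∀ t (xs : Fin t → BinVec n) →
  (∀ i → IsBinaryRank (appendCol A (xs i)) r) →
  IsBinaryRank (appendCols A xs) r

-- Since U is disjoint in rows, a binary vector is a subset sum of U exactly when it vanishes off
-- the supports of the vectors of U and is constant on each of these blocks; the columns of A are
-- of this form. Merging duplicate columns shows that a base has the size k of the binary rank, so
-- any family W of at most k vectors spanning the columns of A gives an optimal decomposition, and
-- none of its vectors is idle (used by no column). If some W l took the values 1 and 0 at two points i, i′ of one block,
-- the rows of the coefficient matrix indexed by S = {l : W l i = 1, W l i′ = 0} and
-- T = {l : W l i′ = 1, W l i = 0} would have equal sums, as the columns of A agree at i and i′:
-- for T ≠ ∅ this contradicts the Unique base rows sums property, and for T = ∅ the vector W l is idle.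
-- Hence every such family lies in the span of U. This applies to every base of A, and to the
-- vectors of an optimal decomposition of (A | x) when that matrix has the rank of A, so U spans
-- every such x and therefore all columns of (A | x₁ … xₜ).

module Submission where

open import Defs
open import Data.Bool using (Bool; true; false; not; _∧_; _∨_)
open import Data.Bool.Properties using (∧-comm; ¬-not) renaming (_≟_ to _≟ᵇ_)
open import Data.Empty using (⊥; ⊥-elim)
open import Data.Fin using (Fin; zero; suc; punchIn; punchOut; splitAt; _↑ˡ_; _↑ʳ_; _≟_)
open import Data.Fin.Properties using (any?; all?; punchInᵢ≢i; punchIn-punchOut; splitAt-↑ˡ; splitAt-↑ʳ)
open import Data.Nat using (ℕ; zero; suc; _+_; _*_; _≤_; z≤n; s≤s)
open import Data.Nat.Properties hiding (_≟_)
open import Algebra.Properties.CommutativeMonoid.Sum +-0-commutativeMonoid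
  using (sum; sum-remove; ∑-distrib-+)
open import Data.Product using (∃; _×_; _,_; proj₁; proj₂; Σ-syntax)
open import Data.Sum using (_⊎_; inj₁; inj₂; [_,_]′)
open import Data.Vec.Functional using (removeAt; updateAt)
open import Data.Vec.Functional.Properties using (updateAt-updates; updateAt-minimal)
open import Function using (_∘_; case_of_; Injective)
open import Relation.Binary.PropositionalEquality
open import Relation.Nullary using (¬_; yes; no; contradiction)

∑≡sum : ∀ k (f : Fin k → ℕ) → ∑ k f ≡ sum f
∑≡sum zero    f = refl
∑≡sum (suc k) f = cong (f zero +_) (∑≡sum k (f ∘ suc))

∑-cong : ∀ k {f g : Fin k → ℕ} → f ≗ g → ∑ k f ≡ ∑ k g
∑-cong zero    f≗g = refl
∑-cong (suc k) f≗g = cong₂ _+_ (f≗g zero) (∑-cong k (f≗g ∘ suc))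

∑-zero : ∀ k (f : Fin k → ℕ) → (∀ l → f l ≡ 0) → ∑ k f ≡ 0
∑-zero zero    f f≡0 = refl
∑-zero (suc k) f f≡0 = cong₂ _+_ (f≡0 zero) (∑-zero k (f ∘ suc) (f≡0 ∘ suc))

∑-remove : ∀ k (f : Fin (suc k) → ℕ) p → ∑ (suc k) f ≡ f p + ∑ k (removeAt f p)
∑-remove k f p = begin
  ∑ (suc k) f                  ≡⟨ ∑≡sum (suc k) f ⟩
  sum f                        ≡⟨ sum-remove f ⟩
  f p + sum (removeAt f p)     ≡⟨ cong (f p +_) (∑≡sum k (removeAt f p)) ⟨
  f p + ∑ k (removeAt f p)     ∎
  where open ≡-Reasoning

∑-+ : ∀ k (f g : Fin k → ℕ) → ∑ k (λ l → f l + g l) ≡ ∑ k f + ∑ k g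
∑-+ k f g = begin
  ∑ k (λ l → f l + g l)   ≡⟨ ∑≡sum k _ ⟩
  sum (λ l → f l + g l)   ≡⟨ ∑-distrib-+ f g ⟩
  sum f + sum g           ≡⟨ cong₂ _+_ (∑≡sum k f) (∑≡sum k g) ⟨
  ∑ k f + ∑ k g           ∎
  where open ≡-Reasoning

term-≤-∑ : ∀ k (f : Fin k → ℕ) p → f p ≤ ∑ k f
term-≤-∑ (suc k) f p = ≤-trans (m≤m+n (f p) _) (≤-reflexive (sym (∑-remove k f p)))

∑≡0⇒term≡0 : ∀ k (f : Fin k → ℕ) → ∑ k f ≡ 0 → ∀ p → f p ≡ 0
∑≡0⇒term≡0 k f ∑≡0 p = n≤0⇒n≡0 (≤-trans (term-≤-∑ k f p) (≤-reflexive ∑≡0))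

∑-single : ∀ k (f : Fin k → ℕ) p → (∀ q → q ≢ p → f q ≡ 0) → ∑ k f ≡ f p
∑-single (suc k) f p others≡0 = begin
  ∑ (suc k) f                   ≡⟨ ∑-remove k f p ⟩
  f p + ∑ k (removeAt f p)      ≡⟨ cong (f p +_) (∑-zero k _ (λ q → others≡0 _ (punchInᵢ≢i p q))) ⟩
  f p + 0                       ≡⟨ +-identityʳ (f p) ⟩
  f p                           ∎
  where open ≡-Reasoning

∑-bump : ∀ k (f g : Fin k → ℕ) c p → g p ≡ c + f p → (∀ q → q ≢ p → g q ≡ f q) →
         ∑ k g ≡ c + ∑ k f
∑-bump (suc k) f g c p gp others = begin
  ∑ (suc k) g                          ≡⟨ ∑-remove k g p ⟩
  g p + ∑ k (removeAt g p)             ≡⟨ cong₂ _+_ gp (∑-cong k (λ q → others _ (punchInᵢ≢i p q))) ⟩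
  c + f p + ∑ k (removeAt f p)         ≡⟨ +-assoc c (f p) _ ⟩
  c + (f p + ∑ k (removeAt f p))       ≡⟨ cong (c +_) (∑-remove k f p) ⟨
  c + ∑ (suc k) f                      ∎
  where open ≡-Reasoning

⟦⟧-injective : ∀ {a b} → ⟦ a ⟧ ≡ ⟦ b ⟧ → a ≡ b
⟦⟧-injective {false} {false} _ = refl
⟦⟧-injective {true}  {true}  _ = refl

⟦⟧≤1 : ∀ b → ⟦ b ⟧ ≤ 1
⟦⟧≤1 false = z≤n
⟦⟧≤1 true  = ≤-refl

*-⟦false⟧ : ∀ x {b} → b ≡ false → x * ⟦ b ⟧ ≡ 0
*-⟦false⟧ x refl = *-zeroʳ x

⟦∨⟧* : ∀ a b w → ⟦ b ⟧ * ⟦ w ⟧ + ⟦ a ⟧ * ⟦ w ⟧ ≤ 1 → ⟦ a ∨ b ⟧ * ⟦ w ⟧ ≡ ⟦ b ⟧ * ⟦ w ⟧ + ⟦ a ⟧ * ⟦ w ⟧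
⟦∨⟧* true  true  true  (s≤s ())
⟦∨⟧* true  true  false _ = refl
⟦∨⟧* true  false w     _ = refl
⟦∨⟧* false b     w     _ = sym (+-identityʳ _)

true-or-allFalse : ∀ {k} (b : Fin k → Bool) → (∃ λ l → b l ≡ true) ⊎ (∀ l → b l ≡ false)
true-or-allFalse b with any? (λ l → b l ≟ᵇ true)
... | yes t = inj₁ t
... | no ¬t = inj₂ (λ l → ¬-not (¬t ∘ (l ,_)))

∑-split-∧ : ∀ k (y : Fin k → ℕ) (a b : Fin k → Bool) →
            ∑ k (λ l → y l * ⟦ a l ⟧) ≡ ∑ k (λ l → ⟦ a l ∧ not (b l) ⟧ * y l) + ∑ k (λ l → ⟦ a l ∧ b l ⟧ * y l)
∑-split-∧ k y a b = trans (∑-cong k (λ l → split (a l) (b l) (y l))) (∑-+ k _ _)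
  where
  split : ∀ a b y → y * ⟦ a ⟧ ≡ ⟦ a ∧ not b ⟧ * y + ⟦ a ∧ b ⟧ * y
  split false b     y = *-zeroʳ y
  split true  false y = trans (*-identityʳ y) (sym (trans (+-identityʳ (y + 0)) (+-identityʳ y)))
  split true  true  y = trans (*-identityʳ y) (sym (+-identityʳ y))

∑-cancel-common : ∀ k (y : Fin k → ℕ) (a b : Fin k → Bool) →
                  ∑ k (λ l → y l * ⟦ a l ⟧) ≡ ∑ k (λ l → y l * ⟦ b l ⟧) →
                  ∑ k (λ l → ⟦ a l ∧ not (b l) ⟧ * y l) ≡ ∑ k (λ l → ⟦ b l ∧ not (a l) ⟧ * y l)
∑-cancel-common k y a b ∑a≡∑b = +-cancelʳ-≡ common _ _ (begin
  ∑ k (λ l → ⟦ a l ∧ not (b l) ⟧ * y l) + common   ≡⟨ ∑-split-∧ k y a b ⟨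
  ∑ k (λ l → y l * ⟦ a l ⟧)                        ≡⟨ ∑a≡∑b ⟩
  ∑ k (λ l → y l * ⟦ b l ⟧)                        ≡⟨ ∑-split-∧ k y b a ⟩
  ∑ k (λ l → ⟦ b l ∧ not (a l) ⟧ * y l) + ∑ k (λ l → ⟦ b l ∧ a l ⟧ * y l)
    ≡⟨ cong (∑ k (λ l → ⟦ b l ∧ not (a l) ⟧ * y l) +_) (∑-cong k (λ l → cong (λ c → ⟦ c ⟧ * y l) (∧-comm (b l) (a l)))) ⟩
  ∑ k (λ l → ⟦ b l ∧ not (a l) ⟧ * y l) + common   ∎)
  where
  open ≡-Reasoning
  common : ℕ
  common = ∑ k (λ l → ⟦ a l ∧ b l ⟧ * y l)

spans⇒decomp : ∀ {n m k} {A : BinMat n m} {W : Fin k → BinVec n} →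
               SpansColumns A W → HasDecomp A k
spans⇒decomp {k = k} {W = W} sp =
  (λ i l → W l i) , (λ l j → proj₁ (sp j) l) ,
  (λ i j → trans (proj₂ (sp j) i) (∑-cong k (λ l → *-comm ⟦ proj₁ (sp j) l ⟧ ⟦ W l i ⟧)))

decomp⇒spans : ∀ {n m k} {A : BinMat n m} → HasDecomp A k →
               Σ[ W ∈ (Fin k → BinVec n) ] SpansColumns A W
decomp⇒spans {k = k} (X , Y , A≡XY) =
  (λ l i → X i l) ,
  (λ j → (λ l → Y l j) , (λ i → trans (A≡XY i j) (∑-cong k (λ l → *-comm ⟦ X i l ⟧ ⟦ Y l j ⟧))))

spansVec-removeAt : ∀ {n k} (W : Fin (suc k) → BinVec n) {v} p → ((s , _) : SpansVec W v) →
                    (∀ i → ⟦ s p ⟧ * ⟦ W p i ⟧ ≡ 0) → SpansVec (removeAt W p) v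
spansVec-removeAt {n} {k} W p (s , v≡∑) idle =
  removeAt s p ,
  λ i → trans (v≡∑ i) (trans (∑-remove k (f i) p) (cong (_+ ∑ k (removeAt (f i) p)) (idle i)))
  where
  f : Fin n → Fin (suc k) → ℕ
  f i l = ⟦ s l ⟧ * ⟦ W l i ⟧

-- The duplicate W p is absorbed into its copy W (punchIn p q) by or-ing the two coefficients;
-- since v is binary, both cannot contribute at the same coordinate.
spansVec-removeDuplicate : ∀ {n k} (W : Fin (suc k) → BinVec n) {v} p q →
                           W (punchIn p q) ≗ W p → SpansVec W v → SpansVec (removeAt W p) v
spansVec-removeDuplicate {k = k} W {v} p q dup (s , v≡∑) = s′ , v≡∑′
  where
  s′ : Fin k → Bool
  s′ = updateAt (removeAt s p) q (_∨ s p)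
  v≡∑′ : ∀ i → ⟦ v i ⟧ ≡ ∑ k (λ r → ⟦ s′ r ⟧ * ⟦ W (punchIn p r) i ⟧)
  v≡∑′ i = begin
    ⟦ v i ⟧                         ≡⟨ v≡∑ i ⟩
    ∑ (suc k) f                     ≡⟨ ∑-remove k f p ⟩
    f p + ∑ k (removeAt f p)        ≡⟨ ∑-bump k (removeAt f p) g (f p) q gq gr ⟨
    ∑ k g                           ∎
    where
    open ≡-Reasoning
    f : Fin (suc k) → ℕ
    f l = ⟦ s l ⟧ * ⟦ W l i ⟧
    g : Fin k → ℕ
    g r = ⟦ s′ r ⟧ * ⟦ W (punchIn p r) i ⟧
    pair≤1 : f p + removeAt f p q ≤ 1
    pair≤1 = ≤-trans (+-monoʳ-≤ (f p) (term-≤-∑ k (removeAt f p) q))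
               (≤-trans (≤-reflexive (sym (trans (v≡∑ i) (∑-remove k f p)))) (⟦⟧≤1 (v i)))
    gq : g q ≡ f p + removeAt f p q
    gq = begin
      ⟦ s′ q ⟧ * ⟦ W (punchIn p q) i ⟧
        ≡⟨ cong (λ b → ⟦ b ⟧ * ⟦ W (punchIn p q) i ⟧) (updateAt-updates q (removeAt s p)) ⟩
      ⟦ s (punchIn p q) ∨ s p ⟧ * ⟦ W (punchIn p q) i ⟧
        ≡⟨ ⟦∨⟧* (s (punchIn p q)) (s p) _ (subst (λ b → ⟦ s p ⟧ * ⟦ b ⟧ + removeAt f p q ≤ 1) (sym (dup i)) pair≤1) ⟩
      ⟦ s p ⟧ * ⟦ W (punchIn p q) i ⟧ + removeAt f p q
        ≡⟨ cong (λ b → ⟦ s p ⟧ * ⟦ b ⟧ + removeAt f p q) (dup i) ⟩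
      f p + removeAt f p q
        ∎
    gr : ∀ r → r ≢ q → g r ≡ removeAt f p r
    gr r r≢q = cong (λ b → ⟦ b ⟧ * ⟦ W (punchIn p r) i ⟧) (updateAt-minimal r q (removeAt s p) r≢q)

Duplicated : ∀ {n k} → (Fin (suc k) → BinVec n) → Set
Duplicated {k = k} W = Σ[ p ∈ Fin (suc k) ] Σ[ q ∈ Fin k ] W (punchIn p q) ≗ W p

injective-or-duplicated : ∀ {n k} (W : Fin (suc k) → BinVec n) → Injective _≡_ _≡_ W ⊎ Duplicated W
injective-or-duplicated W with any? (λ p → any? (λ q → all? (λ i → W (punchIn p q) i ≟ᵇ W p i)))
... | yes (p , q , dup) = inj₂ (p , q , dup)
... | no ¬dup = inj₁ injective
  where
  injective : ∀ {a b} → W a ≡ W b → a ≡ b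
  injective {a} {b} Wa≡Wb with a ≟ b
  ... | yes a≡b = a≡b
  ... | no a≢b = contradiction (b , punchOut b≢a , dup) ¬dup
    where
    b≢a : b ≢ a
    b≢a = a≢b ∘ sym
    dup : ∀ i → W (punchIn b (punchOut b≢a)) i ≡ W b i
    dup i rewrite punchIn-punchOut b≢a = cong (λ w → w i) Wa≡Wb

module _ {n m k} {A : BinMat n m} {U : Fin k → BinVec n} (base : IsBase A U) where

  base-minimal : ∀ {k′} (W : Fin k′ → BinVec n) → SpansColumns A W → k ≤ k′
  base-minimal {zero}   W sp = proj₂ (proj₂ base) zero W (λ { {()} }) sp
  base-minimal {suc k′} W sp with injective-or-duplicated W
  ... | inj₁ injective = proj₂ (proj₂ base) (suc k′) W injective sp
  ... | inj₂ (p , q , dup) =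
        m≤n⇒m≤1+n (base-minimal (removeAt W p) (λ j → spansVec-removeDuplicate W p q dup (sp j)))

  base-≤-rank : ∀ {k′} → HasDecomp A k′ → k ≤ k′
  base-≤-rank D = base-minimal _ (proj₂ (decomp⇒spans D))

  spanning-noIdle : ∀ {k′} (W : Fin k′ → BinVec n) (sp : SpansColumns A W) → k′ ≤ k →
                    ∀ p → ¬ (∀ j i → ⟦ proj₁ (sp j) p ⟧ * ⟦ W p i ⟧ ≡ 0)
  spanning-noIdle {suc k′} W sp k′<k p idle =
    <-irrefl refl (<-≤-trans k′<k (base-minimal (removeAt W p) (λ j → spansVec-removeAt W p (sp j) (idle j))))

  spanning-used : ∀ {k′} (W : Fin k′ → BinVec n) (sp : SpansColumns A W) → k′ ≤ k →
                  ∀ p → ¬ (∀ j → proj₁ (sp j) p ≡ false)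
  spanning-used W sp k′≤k p unused =
    spanning-noIdle W sp k′≤k p (λ j i → cong (λ b → ⟦ b ⟧ * ⟦ W p i ⟧) (unused j))

  spanning-nonzero : ∀ {k′} (W : Fin k′ → BinVec n) (sp : SpansColumns A W) → k′ ≤ k →
                     ∀ p → ¬ (∀ i → W p i ≡ false)
  spanning-nonzero W sp k′≤k p zero-vector =
    spanning-noIdle W sp k′≤k p (λ j i → *-⟦false⟧ ⟦ proj₁ (sp j) p ⟧ (zero-vector i))

-- The blocks of U are the supports of its vectors.
RespectsBlocks : ∀ {n k} → (Fin k → BinVec n) → BinVec n → Set
RespectsBlocks U v =
  (∀ i → (∀ p → U p i ≡ false) → v i ≡ false) ×
  (∀ p i i′ → U p i ≡ true → U p i′ ≡ true → v i ≡ v i′)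

respectsBlocks-spanned : ∀ {n k k′} {U : Fin k → BinVec n} {W : Fin k′ → BinVec n} {v} →
                         (∀ l → RespectsBlocks U (W l)) → SpansVec W v → RespectsBlocks U v
respectsBlocks-spanned {k′ = k′} {U} {W} {v} W-blocks (s , v≡∑) = vanishes , constant
  where
  vanishes : ∀ i → (∀ p → U p i ≡ false) → v i ≡ false
  vanishes i off = ⟦⟧-injective (trans (v≡∑ i)
    (∑-zero k′ _ (λ l → *-⟦false⟧ ⟦ s l ⟧ (proj₁ (W-blocks l) i off))))
  constant : ∀ p i i′ → U p i ≡ true → U p i′ ≡ true → v i ≡ v i′
  constant p i i′ hi hi′ = ⟦⟧-injective (trans (v≡∑ i) (trans
    (∑-cong k′ (λ l → cong (λ b → ⟦ s l ⟧ * ⟦ b ⟧) (proj₂ (W-blocks l) p i i′ hi hi′))) (sym (v≡∑ i′))))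

module _ {n k} {U : Fin k → BinVec n} (disjoint : DisjointInRows U) where

  disjoint-false : ∀ {p q i} → U p i ≡ true → q ≢ p → U q i ≡ false
  disjoint-false {p} {q} {i} Upi q≢p with U q i in Uqi
  ... | true  = ⊥-elim (disjoint q p i q≢p Uqi Upi)
  ... | false = refl

  respectsBlocks-self : ∀ l → RespectsBlocks U (U l)
  respectsBlocks-self l = (λ i off → off l) , constant
    where
    constant : ∀ p i i′ → U p i ≡ true → U p i′ ≡ true → U l i ≡ U l i′
    constant p i i′ Upi Upi′ with l ≟ p
    ... | yes refl = trans Upi (sym Upi′)
    ... | no l≢p   = trans (disjoint-false Upi l≢p) (sym (disjoint-false Upi′ l≢p))

  -- The coefficient of U p is the value of v at any point of the block of p.
  respectsBlocks⇒spanned : (∀ p → ∃ λ i → U p i ≡ true) → ∀ {v} → RespectsBlocks U v → SpansVec U v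
  respectsBlocks⇒spanned block-point {v} (vanishes , constant) = s , v≡∑
    where
    s : Fin k → Bool
    s p = v (proj₁ (block-point p))
    v≡∑ : ∀ i → ⟦ v i ⟧ ≡ ∑ k (λ p → ⟦ s p ⟧ * ⟦ U p i ⟧)
    v≡∑ i with true-or-allFalse (λ p → U p i)
    ... | inj₁ (p , Upi) = sym (begin
      ∑ k (λ q → ⟦ s q ⟧ * ⟦ U q i ⟧)
        ≡⟨ ∑-single k _ p (λ q q≢p → *-⟦false⟧ ⟦ s q ⟧ (disjoint-false Upi q≢p)) ⟩
      ⟦ s p ⟧ * ⟦ U p i ⟧
        ≡⟨ cong (λ b → ⟦ s p ⟧ * ⟦ b ⟧) Upi ⟩
      ⟦ s p ⟧ * 1
        ≡⟨ *-identityʳ ⟦ s p ⟧ ⟩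
      ⟦ s p ⟧
        ≡⟨ cong ⟦_⟧ (constant p _ i (proj₂ (block-point p)) Upi) ⟩
      ⟦ v i ⟧ ∎)
      where open ≡-Reasoning
    ... | inj₂ off = trans (cong ⟦_⟧ (vanishes i off))
      (sym (∑-zero k _ (λ p → *-⟦false⟧ ⟦ s p ⟧ (off p))))

module _ {n m t} {A : BinMat n m} {xs : Fin t → BinVec n} {k} {W : Fin k → BinVec n} where

  spansColumns-appendCols : SpansColumns A W → (∀ c → SpansVec W (xs c)) →
                            SpansColumns (appendCols A xs) W
  spansColumns-appendCols spA spxs j with splitAt m j
  ... | inj₁ j′ = spA j′
  ... | inj₂ c  = spxs c

  appendCols-spans-left : SpansColumns (appendCols A xs) W → SpansColumns A W
  appendCols-spans-left sp j =
    subst (SpansVec W) (cong (λ s i → [ (λ c → A i c) , (λ c → xs c i) ]′ s) (splitAt-↑ˡ m j t)) (sp (j ↑ˡ t))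

  appendCols-spans-right : SpansColumns (appendCols A xs) W → ∀ c → SpansVec W (xs c)
  appendCols-spans-right sp c =
    subst (SpansVec W) (cong (λ s i → [ (λ c → A i c) , (λ c → xs c i) ]′ s) (splitAt-↑ʳ m t c)) (sp (m ↑ʳ c))

module _ {n m k} {A : BinMat n m} {U : Fin k → BinVec n}
         (base : IsBase A U) (disjoint : DisjointInRows U) (unique-sums : UniqueBaseRowsSums A) where

  columns-respectBlocks : ∀ j → RespectsBlocks U (col A j)
  columns-respectBlocks j =
    respectsBlocks-spanned (respectsBlocks-self disjoint) (proj₁ (proj₂ base) j)

  module _ {k′} (W : Fin k′ → BinVec n) (sp : SpansColumns A W) (k′≤k : k′ ≤ k) where

    coefficient : Fin m → Fin k′ → Bool
    coefficient j l = proj₁ (sp j) l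

    X : BinMat n k′
    X = proj₁ (spans⇒decomp sp)

    Y : BinMat k′ m
    Y = proj₁ (proj₂ (spans⇒decomp sp))

    optimal : IsOptimalDecomp A X Y
    optimal = proj₂ (proj₂ (spans⇒decomp sp)) ,
              spans⇒decomp sp ,
              (λ k″ D → ≤-trans k′≤k (base-≤-rank base D))

    vanishes-off-blocks : ∀ l i → (∀ p → U p i ≡ false) → W l i ≡ false
    vanishes-off-blocks l i off with W l i in Wli | true-or-allFalse (λ j → coefficient j l)
    ... | false | _              = refl
    ... | true  | inj₂ unused    = ⊥-elim (spanning-used base W sp k′≤k l unused)
    ... | true  | inj₁ (j , cjl) = case subst₂ (λ c w → ⟦ c ⟧ * ⟦ w ⟧ ≡ 0) cjl Wli term of λ ()
      where
      term : ⟦ coefficient j l ⟧ * ⟦ W l i ⟧ ≡ 0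
      term = ∑≡0⇒term≡0 k′ _ (trans (sym (proj₂ (sp j) i))
               (cong ⟦_⟧ (proj₁ (columns-respectBlocks j) i off))) l

    module _ {p i i′} (Upi : U p i ≡ true) (Upi′ : U p i′ ≡ true) where

      S T : Fin k′ → Bool
      S l = W l i ∧ not (W l i′)
      T l = W l i′ ∧ not (W l i)

      S-member : ∀ {l} → W l i ≡ true → W l i′ ≡ false → S l ≡ true
      S-member Wli Wli′ = cong₂ (λ a b → a ∧ not b) Wli Wli′

      S∩T≡∅ : DisjointSubsets S T
      S∩T≡∅ q = disjoint-differences (W q i) (W q i′)
        where
        disjoint-differences : ∀ a b → a ∧ not b ≡ true → b ∧ not a ≡ true → ⊥
        disjoint-differences true  false _ ()
        disjoint-differences false _     ()
        disjoint-differences true  true  ()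

      -- Column j of A takes the same value at i and i′, and the common rows of S and T cancel.
      rowSums-S≡T : ∀ j → RowSum Y S j ≡ RowSum Y T j
      rowSums-S≡T j = ∑-cancel-common k′ (λ l → ⟦ coefficient j l ⟧) (λ l → W l i) (λ l → W l i′)
        (trans (sym (proj₂ (sp j) i))
          (trans (cong ⟦_⟧ (proj₂ (columns-respectBlocks j) p i i′ Upi Upi′)) (proj₂ (sp j) i′)))

      no-split : ∀ l → W l i ≡ true → W l i′ ≡ false → ⊥
      no-split l Wli Wli′ with true-or-allFalse T
      ... | inj₁ T≠∅ = unique-sums k′ X Y optimal S T (l , S-member Wli Wli′) T≠∅ S∩T≡∅ rowSums-S≡T
      ... | inj₂ T≡∅ = spanning-used base W sp k′≤k l unused
        where
        rowSum-S≡0 : ∀ j → RowSum Y S j ≡ 0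
        rowSum-S≡0 j = trans (rowSums-S≡T j) (∑-zero k′ _ (λ q → cong (λ c → ⟦ c ⟧ * ⟦ coefficient j q ⟧) (T≡∅ q)))
        unused : ∀ j → coefficient j l ≡ false
        unused j = ⟦⟧-injective (trans (sym (+-identityʳ ⟦ coefficient j l ⟧))
          (subst (λ c → ⟦ c ⟧ * ⟦ coefficient j l ⟧ ≡ 0) (S-member Wli Wli′) (∑≡0⇒term≡0 k′ _ (rowSum-S≡0 j) l)))

    spanning-respectsBlocks : ∀ l → RespectsBlocks U (W l)
    spanning-respectsBlocks l = vanishes-off-blocks l , constant
      where
      constant : ∀ p i i′ → U p i ≡ true → U p i′ ≡ true → W l i ≡ W l i′
      constant p i i′ Upi Upi′ with W l i in Wli | W l i′ in Wli′
      ... | false | false = refl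
      ... | true  | true  = refl
      ... | true  | false = ⊥-elim (no-split Upi Upi′ l Wli Wli′)
      ... | false | true  = ⊥-elim (no-split Upi′ Upi l Wli′ Wli)

  block-point : ∀ p → ∃ λ i → U p i ≡ true
  block-point p with true-or-allFalse (U p)
  ... | inj₁ Upi  = Upi
  ... | inj₂ Up≡0 = ⊥-elim (spanning-nonzero base U (proj₁ (proj₂ base)) ≤-refl p Up≡0)

  base-spans-bases : ∀ {k′} (V : Fin k′ → BinVec n) → IsBase A V → Spans U V
  base-spans-bases V (_ , spV , minV) l =
    respectsBlocks⇒spanned disjoint block-point
      (spanning-respectsBlocks V spV (minV _ U (proj₁ base) (proj₁ (proj₂ base))) l)

  augmentation : AugmentationProperty A
  augmentation r (Dr , rank-minimal) t xs rank-xs = Dxs , (λ k″ D → rank-minimal k″ (restrict D))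
    where
    r≤k : r ≤ k
    r≤k = rank-minimal k (spans⇒decomp (proj₁ (proj₂ base)))
    k≡r : k ≡ r
    k≡r = ≤-antisym (base-≤-rank base Dr) r≤k
    restrict : ∀ {k″} → HasDecomp (appendCols A xs) k″ → HasDecomp A k″
    restrict D = spans⇒decomp (appendCols-spans-left (proj₂ (decomp⇒spans D)))
    -- The vectors of an optimal decomposition of (A | x) span A with r ≤ k vectors, so they respect the blocks.
    x-spanned : ∀ c → SpansVec U (xs c)
    x-spanned c with decomp⇒spans (proj₁ (rank-xs c))
    ... | W , spW = respectsBlocks⇒spanned disjoint block-point
      (respectsBlocks-spanned (spanning-respectsBlocks W (appendCols-spans-left spW) r≤k)
                              (appendCols-spans-right spW zero))
    Dxs : HasDecomp (appendCols A xs) r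
    Dxs = subst (HasDecomp (appendCols A xs)) k≡r
      (spans⇒decomp (spansColumns-appendCols (proj₁ (proj₂ base)) x-spanned))

mainTheorem17 : ∀ {n m k} (A : BinMat n m) (U : Fin k → BinVec n) →
    IsBase A U → DisjointInRows U → UniqueBaseRowsSums A →
    (∀ k' (V : Fin k' → BinVec n) → IsBase A V → Spans U V) ×
    AugmentationProperty A
mainTheorem17 A U base disjoint unique-sums =
  (λ _ → base-spans-bases base disjoint unique-sums) , augmentation base disjoint unique-sums
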